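{- For all $n \geq 2$ and all $P \in \mathcal{C}(G_n)$, $P$ is not completely separable (i.e. $\mathrm{char}(P)\neq\mathcal{P}(Q_n)$).
   Context: Let $Q_n=\{1,\dots,n\}$ be a set of $n$ yes/no questions; an outcome on $S\subseteq Q_n$ is an element of $\{0,1\}^{|S|}$, and $X_S$ is the set of outcomes on $S$. A preference matrix on $Q_n$ is a $2^n\times n$ 0-1 matrix whose rows are the $2^n$ outcomes, each exactly once, ordered from most to least preferred. For a nonempty proper $S\subset Q_n$ and outcome $x$ on $Q_n-S$, $P^{[Q_n-S,x]}$ is the submatrix formed by the columns in $S$ and rows with outcome $x$ on $Q_n-S$ (in order); $S$ is separable with respect to $P$ if $P^{[Q_n-S,x]}=P^{[Q_n-S,y]}$ for all $x,y\in X_{Q_n-S}$; $\emptyset$ and $Q_n$ are always separable. The character $\mathrm{char}(P)$ is the set of all subsets of $Q_n$ separable with respect to $P$; $P$ is completely separable if $\mathrm{char}(P)$ is the power set $\mathcal{P}(Q_n)$. $\mathcal{C}(G_n)$ is the set of preference matrices generated by Hamiltonian paths in the $n$-dimensional hypercube graph $G_n$ with Gray code labeling, i.e. preference matrices in which consecutive rows differ in exactly one entry. -}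

module Defs where

open import Data.Bool using (Bool; true; false; if_then_else_; _xor_)
open import Data.Bool.Properties using () renaming (_≟_ to _≟ᵇ_)
open import Data.Nat using (ℕ; _^_; _+_)
open import Data.Fin.Subset using (Subset; ∁; ⊥; ⊤; ∣_∣)
open import Data.Vec using (Vec; []; _∷_; zipWith; foldr)

open import Data.List using (List; []; _∷_; map; filter; length)
open import Data.List.Properties using ()
  renaming (≡-dec to ≡-decL)
open import Data.List.Membership.Propositional using (_∈_)
open import Data.List.Relation.Unary.Unique.Propositional using (Unique)
open import Data.List.Relation.Unary.Linked using (Linked)
open import Data.Product using (_×_)
open import Data.Sum using (_⊎_)
open import Relation.Binary.PropositionalEquality using (_≡_)

-- An outcome on Q_n = {1..n} (indexed by Fin n): a 0-1 vector (true = 1).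
Outcome : ℕ → Set
Outcome n = Vec Bool n

-- A preference matrix on Q_n: its rows, listed from most to least preferred,
-- containing every one of the 2^n outcomes exactly once.
record PrefMatrix (n : ℕ) : Set where
  field
    rows     : List (Outcome n)
    unique   : Unique rows
    complete : (x : Outcome n) → x ∈ rows
    size     : length rows ≡ 2 ^ n
open PrefMatrix public

restrict : {n : ℕ} → Subset n → Outcome n → List Bool
restrict []          []       = []
restrict (true ∷ S)  (b ∷ r)  = b ∷ restrict S r
restrict (false ∷ S) (b ∷ r)  = restrict S r

-- P^[Q_n - S, x]: columns in S of the rows (in order) whose outcome on Q_n - S is x.
subMatrix : {n : ℕ} → PrefMatrix n → Subset n → List Bool → List (List Bool)
subMatrix P S x =
  map (restrict S) (filter (λ r → ≡-decL _≟ᵇ_ (restrict (∁ S) r) x) (rows P))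

Separable : {n : ℕ} → PrefMatrix n → Subset n → Set
Separable {n} P S =
  (S ≡ ⊥ ⊎ S ≡ ⊤) ⊎
  ((x y : List Bool) → length x ≡ ∣ ∁ S ∣ → length y ≡ ∣ ∁ S ∣ →
     subMatrix P S x ≡ subMatrix P S y)

CompletelySeparable : {n : ℕ} → PrefMatrix n → Set
CompletelySeparable {n} P = (S : Subset n) → Separable P S

hamming : {n : ℕ} → Outcome n → Outcome n → ℕ
hamming r s = foldr _ (λ b k → (if b then 1 else 0) + k) 0 (zipWith _xor_ r s)

DifferInOne : {n : ℕ} → Outcome n → Outcome n → Set
DifferInOne r s = hamming r s ≡ 1

-- P ∈ C(G_n): consecutive rows differ in exactly one entry
-- (P is generated by a Hamiltonian path in the hypercube G_n).
InCGn : {n : ℕ} → PrefMatrix n → Set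
InCGn P = Linked DifferInOne (rows P)

-- Consecutive rows r₀, r₁, r₂ of a Gray-code preference matrix differ in single
-- questions i and j, and i ≠ j because r₀ ≠ r₂. Take S = {i}. On Q_n - S the
-- rows r₀ and r₁ agree while r₂ differs (in question j), so r₀ is the first row
-- of P^[Q_n-S, x] and r₂ the first row of P^[Q_n-S, y] for the outcomes x, y of
-- r₀, r₂ on Q_n - S. If S were separable these two first rows would coincide on
-- S, yet r₀ and r₂ differ in question i.
module Submission where

open import Defs
open import Data.Nat using (ℕ; _≤_; suc; s≤s)
open import Relation.Nullary using (¬_; Dec; yes; no)

open import Data.Bool using (Bool; true; false)
open import Data.Bool.Properties using (¬-not) renaming (_≟_ to _≟ᵇ_)
open import Data.Empty using (⊥-elim)
open import Data.Fin using (Fin; zero; suc) renaming (_≟_ to _≟ᶠ_)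
open import Data.Fin.Subset using (Subset; _∈_; ⁅_⁆; ∁; ⊥; ⊤; ∣_∣)
open import Data.Fin.Subset.Properties using (x∈⁅x⁆; x≢y⇒x∉⁅y⁆; x∉p⇒x∈∁p)
open import Data.List using (List; []; _∷_; length; filter; map; head)
open import Data.List.Properties using (∷-injectiveˡ; ∷-injectiveʳ; filter-accept; filter-reject)
  renaming (≡-dec to ≡-decL)
open import Data.List.Relation.Unary.AllPairs using (_∷_)
open import Data.List.Relation.Unary.All using (_∷_)
open import Data.List.Relation.Unary.Linked using (Linked; _∷_)
open import Data.List.Relation.Unary.Unique.Propositional using (Unique)
open import Data.Maybe using (just)
open import Data.Maybe.Properties using (just-injective)
open import Data.Nat.Properties using (suc-injective; ^-monoʳ-≤; ≤-trans; ≤-reflexive; n≤1+n)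
open import Data.Product using (∃; _,_) renaming (map to map-∃)
open import Data.Sum using (inj₁; inj₂)
open import Data.Vec using (Vec; []; _∷_; lookup; tabulate; here; there)
open import Data.Vec.Properties using (tabulate∘lookup; tabulate-cong)
open import Function using (_∘_)
open import Relation.Binary.PropositionalEquality
  using (_≡_; _≢_; refl; sym; trans; cong; module ≡-Reasoning)

lookup-extensional : ∀ {n} {A : Set} {xs ys : Vec A n} →
                     (∀ i → lookup xs i ≡ lookup ys i) → xs ≡ ys
lookup-extensional {xs = xs} {ys} xs≗ys = begin
  xs                   ≡⟨ tabulate∘lookup xs ⟨
  tabulate (lookup xs) ≡⟨ tabulate-cong xs≗ys ⟩
  tabulate (lookup ys) ≡⟨ tabulate∘lookup ys ⟩
  ys                   ∎
  where open ≡-Reasoning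

record DifferOnlyAt {n : ℕ} (a b : Outcome n) (i : Fin n) : Set where
  field
    differ : lookup a i ≢ lookup b i
    agree  : ∀ {j} → j ≢ i → lookup a j ≡ lookup b j
open DifferOnlyAt

differOnlyAt-∷ : ∀ {n x i} {a b : Outcome n} →
                 DifferOnlyAt a b i → DifferOnlyAt (x ∷ a) (x ∷ b) (suc i)
differOnlyAt-∷ d .differ = differ d
differOnlyAt-∷ d .agree {zero}  _   = refl
differOnlyAt-∷ d .agree {suc j} j≢i = agree d (j≢i ∘ cong suc)

differOnlyAt-head : ∀ {n x y} {a : Outcome n} → x ≢ y → DifferOnlyAt (x ∷ a) (y ∷ a) zero
differOnlyAt-head x≢y .differ = x≢y
differOnlyAt-head x≢y .agree {zero}  0≢0 = ⊥-elim (0≢0 refl)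
differOnlyAt-head x≢y .agree {suc j} _   = refl

hamming≡0⇒≡ : ∀ {n} {a b : Outcome n} → hamming a b ≡ 0 → a ≡ b
hamming≡0⇒≡ {a = []}        {[]}        _ = refl
hamming≡0⇒≡ {a = true ∷ a}  {true ∷ b}  h = cong (true ∷_) (hamming≡0⇒≡ h)
hamming≡0⇒≡ {a = false ∷ a} {false ∷ b} h = cong (false ∷_) (hamming≡0⇒≡ h)

differInOne⇒differOnlyAt : ∀ {n} {a b : Outcome n} → DifferInOne a b → ∃ (DifferOnlyAt a b)
differInOne⇒differOnlyAt {a = []}        {[]}        ()
differInOne⇒differOnlyAt {a = true ∷ a}  {true ∷ b}  h =
  map-∃ suc differOnlyAt-∷ (differInOne⇒differOnlyAt h)
differInOne⇒differOnlyAt {a = false ∷ a} {false ∷ b} h =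
  map-∃ suc differOnlyAt-∷ (differInOne⇒differOnlyAt h)
differInOne⇒differOnlyAt {a = true ∷ a}  {false ∷ b} h
  with refl ← hamming≡0⇒≡ {a = a} {b} (suc-injective h) = zero , differOnlyAt-head λ ()
differInOne⇒differOnlyAt {a = false ∷ a} {true ∷ b}  h
  with refl ← hamming≡0⇒≡ {a = a} {b} (suc-injective h) = zero , differOnlyAt-head λ ()

-- Flipping the same question twice returns to the start.
differOnlyAt-successive : ∀ {n i j} {a b c : Outcome n} →
  DifferOnlyAt a b i → DifferOnlyAt b c j → a ≢ c → i ≢ j
differOnlyAt-successive {i = i} {a = a} {c = c} dᵢ dⱼ a≢c refl =
  a≢c (lookup-extensional agreeAt)
  where
  agreeAt : ∀ k → lookup a k ≡ lookup c k
  agreeAt k with k ≟ᶠ i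
  ... | yes refl = trans (¬-not (differ dᵢ)) (sym (¬-not (differ dⱼ ∘ sym)))
  ... | no k≢i   = trans (agree dᵢ k≢i) (agree dⱼ k≢i)

restrict-≡⇒lookup-≡ : ∀ {n i} {S : Subset n} {a b : Outcome n} →
                      restrict S a ≡ restrict S b → i ∈ S → lookup a i ≡ lookup b i
restrict-≡⇒lookup-≡ {S = true ∷ S}  {_ ∷ a} {_ ∷ b} eq here        = ∷-injectiveˡ eq
restrict-≡⇒lookup-≡ {S = true ∷ S}  {_ ∷ a} {_ ∷ b} eq (there i∈S) =
  restrict-≡⇒lookup-≡ (∷-injectiveʳ eq) i∈S
restrict-≡⇒lookup-≡ {S = false ∷ S} {_ ∷ a} {_ ∷ b} eq (there i∈S) = restrict-≡⇒lookup-≡ eq i∈S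

restrict-⊥ : ∀ {n} (a : Outcome n) → restrict ⊥ a ≡ []
restrict-⊥ []      = refl
restrict-⊥ (_ ∷ a) = restrict-⊥ a

restrict-∁⊤ : ∀ {n} (a : Outcome n) → restrict (∁ ⊤) a ≡ []
restrict-∁⊤ []      = refl
restrict-∁⊤ (_ ∷ a) = restrict-∁⊤ a

length-restrict : ∀ {n} (S : Subset n) (a : Outcome n) → length (restrict S a) ≡ ∣ S ∣
length-restrict []          []      = refl
length-restrict (true ∷ S)  (_ ∷ a) = cong suc (length-restrict S a)
length-restrict (false ∷ S) (_ ∷ a) = length-restrict S a

leadingRows-¬separable : ∀ {n} (P : PrefMatrix n) (S : Subset n) {r₀ r₁ r₂ rest} →
  rows P ≡ r₀ ∷ r₁ ∷ r₂ ∷ rest →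
  restrict (∁ S) r₀ ≢ restrict (∁ S) r₂ →
  restrict (∁ S) r₁ ≢ restrict (∁ S) r₂ →
  restrict S r₀ ≢ restrict S r₂ →
  ¬ Separable P S
leadingRows-¬separable P S {r₀} {r₂ = r₂} _ _ _ r₀≢r₂ˢ (inj₁ (inj₁ refl)) =
  r₀≢r₂ˢ (trans (restrict-⊥ r₀) (sym (restrict-⊥ r₂)))
leadingRows-¬separable P S {r₀} {r₂ = r₂} _ r₀≢r₂ᶜ _ _ (inj₁ (inj₂ refl)) =
  r₀≢r₂ᶜ (trans (restrict-∁⊤ r₀) (sym (restrict-∁⊤ r₂)))
leadingRows-¬separable {n} P S {r₀} {r₁} {r₂} {rest} rows≡ r₀≢r₂ᶜ r₁≢r₂ᶜ r₀≢r₂ˢ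
                       (inj₂ separable) =
  r₀≢r₂ˢ (just-injective (begin
    just (restrict S r₀)   ≡⟨ firstRow x (filter-accept (outside? x) refl) ⟨
    head (subMatrix P S x) ≡⟨ cong head (separable x y (length-restrict (∁ S) r₀)
                                                       (length-restrict (∁ S) r₂)) ⟩
    head (subMatrix P S y) ≡⟨ firstRow y rowsOutside-y ⟩
    just (restrict S r₂)   ∎))
  where
  open ≡-Reasoning
  x y : List Bool
  x = restrict (∁ S) r₀
  y = restrict (∁ S) r₂
  outside? : (z : List Bool) (r : Outcome n) → Dec (restrict (∁ S) r ≡ z)
  outside? z r = ≡-decL _≟ᵇ_ (restrict (∁ S) r) z
  firstRow : ∀ {r rs} z → filter (outside? z) (r₀ ∷ r₁ ∷ r₂ ∷ rest) ≡ r ∷ rs →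
             head (subMatrix P S z) ≡ just (restrict S r)
  firstRow z filter≡ =
    cong (head ∘ map (restrict S)) (trans (cong (filter (outside? z)) rows≡) filter≡)
  rowsOutside-y : filter (outside? y) (r₀ ∷ r₁ ∷ r₂ ∷ rest) ≡ r₂ ∷ filter (outside? y) rest
  rowsOutside-y = begin
    filter (outside? y) (r₀ ∷ r₁ ∷ r₂ ∷ rest) ≡⟨ filter-reject (outside? y) r₀≢r₂ᶜ ⟩
    filter (outside? y) (r₁ ∷ r₂ ∷ rest)      ≡⟨ filter-reject (outside? y) r₁≢r₂ᶜ ⟩
    filter (outside? y) (r₂ ∷ rest)           ≡⟨ filter-accept (outside? y) refl ⟩
    r₂ ∷ filter (outside? y) rest             ∎

successiveFlips-¬completelySeparable : ∀ {n} (P : PrefMatrix n) {r₀ r₁ r₂ rest i j} →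
  rows P ≡ r₀ ∷ r₁ ∷ r₂ ∷ rest → DifferOnlyAt r₀ r₁ i → DifferOnlyAt r₁ r₂ j → i ≢ j →
  ¬ CompletelySeparable P
successiveFlips-¬completelySeparable P {r₀} {r₁} {r₂} {i = i} {j} rows≡ dᵢ dⱼ i≢j
                                     completelySeparable =
  leadingRows-¬separable P ⁅ i ⁆ rows≡ r₀≢r₂ᶜ r₁≢r₂ᶜ r₀≢r₂ˢ (completelySeparable ⁅ i ⁆)
  where
  j∈∁⁅i⁆ : j ∈ ∁ ⁅ i ⁆
  j∈∁⁅i⁆ = x∉p⇒x∈∁p (x≢y⇒x∉⁅y⁆ (i≢j ∘ sym))
  r₀≢r₂ᶜ : restrict (∁ ⁅ i ⁆) r₀ ≢ restrict (∁ ⁅ i ⁆) r₂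
  r₀≢r₂ᶜ eq = differ dⱼ (trans (sym (agree dᵢ (i≢j ∘ sym))) (restrict-≡⇒lookup-≡ eq j∈∁⁅i⁆))
  r₁≢r₂ᶜ : restrict (∁ ⁅ i ⁆) r₁ ≢ restrict (∁ ⁅ i ⁆) r₂
  r₁≢r₂ᶜ eq = differ dⱼ (restrict-≡⇒lookup-≡ eq j∈∁⁅i⁆)
  r₀≢r₂ˢ : restrict ⁅ i ⁆ r₀ ≢ restrict ⁅ i ⁆ r₂
  r₀≢r₂ˢ eq = differ dᵢ (trans (restrict-≡⇒lookup-≡ eq (x∈⁅x⁆ i)) (sym (agree dⱼ i≢j)))

atLeastThreeRows : ∀ {n} → 2 ≤ n → (P : PrefMatrix n) → 3 ≤ length (rows P)
atLeastThreeRows 2≤n P =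
  ≤-trans (n≤1+n 3) (≤-trans (^-monoʳ-≤ 2 2≤n) (≤-reflexive (sym (size P))))

grayCode-¬completelySeparable : ∀ {n} (P : PrefMatrix n) {rs} → rows P ≡ rs →
  3 ≤ length rs → Unique rs → Linked DifferInOne rs → ¬ CompletelySeparable P
grayCode-¬completelySeparable P {_ ∷ []}         _ (s≤s ())       _ _
grayCode-¬completelySeparable P {_ ∷ _ ∷ []}     _ (s≤s (s≤s ())) _ _
grayCode-¬completelySeparable P {_ ∷ _ ∷ _ ∷ _} rows≡ _ ((_ ∷ r₀≢r₂ ∷ _) ∷ _) (d₀₁ ∷ d₁₂ ∷ _)
  with i , dᵢ ← differInOne⇒differOnlyAt d₀₁
     | j , dⱼ ← differInOne⇒differOnlyAt d₁₂ =
  successiveFlips-¬completelySeparable P rows≡ dᵢ dⱼ (differOnlyAt-successive dᵢ dⱼ r₀≢r₂)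

corollary2 : (n : ℕ) → 2 ≤ n → (P : PrefMatrix n) → InCGn P → ¬ CompletelySeparable P
corollary2 n 2≤n P = grayCode-¬completelySeparable P refl (atLeastThreeRows 2≤n P) (unique P)
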